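{- For the elementary cellular automaton $F_{140}$ and every nonempty finite word $u\in\{0,1\}^*$, $D(\textsc{SInv}_{F_{140},u,n})\in O(1)$ as $n\to\infty$.
   Context: The ECA with Wolfram number $N$ is $F_N:\{0,1\}^{\mathbb{Z}}\to\{0,1\}^{\mathbb{Z}}$, $(F_N(x))_i=f_N(x_{i-1},x_i,x_{i+1})$, where $f_N(a,b,c)$ is the bit of index $4a+2b+c$ of $N$ in binary. For a nonempty word $u$, $p_u\in\{0,1\}^{\mathbb{Z}}$ is $(p_u)_i=u_{i\bmod |u|}$; for a finite word $x$, $p_u[x]$ equals $x$ on positions $\{0,\dots,|x|-1\}$ and $p_u$ elsewhere. $\textsc{SInv}_{F,u,n}:\{0,1\}^n\to\{0,1\}$ maps $x$ to $1$ iff there is an integer $w$ such that for every $t\ge 0$ the set of positions where $F^t(p_u)$ and $F^t(p_u[x])$ differ is contained in an interval of length $w$. For finite sets $X,Y,Z$ and $g:X\times Y\to Z$, $D(g)$ is the minimal depth of a deterministic two-party communication protocol tree computing $g$ (Alice knows $x$, Bob knows $y$; internal nodes are labelled by a function of $x$ alone or of $y$ alone to $\{\mathrm{l},\mathrm{r}\}$, leaves by outputs). For $g:\{0,1\}^m\to Z$, $D(g)=\max_{0\le i\le m} D(g_i)$ with $g_i(x,y)=g(xy)$ for $x\in\{0,1\}^i$, $y\in\{0,1\}^{m-i}$. -}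

module Defs where

open import Data.Bool using (Bool; true; false; if_then_else_)
open import Data.Nat as ℕ using (ℕ; zero; suc; _^_)
open import Data.Nat.DivMod using (_/_; _%_)
open import Data.Integer as ℤ using (ℤ; +_; -[1+_]; _%ℕ_)
open import Data.Integer.DivMod using (n%ℕd<d)
open import Data.Fin using (Fin; fromℕ<)
open import Data.Vec using (Vec; lookup; _++_)
open import Data.Product using (Σ; ∃; _×_; _,_)
open import Relation.Binary.PropositionalEquality using (_≡_; _≢_)
open import Relation.Nullary using (yes; no)
open import Function.Bundles using (_⇔_)

-- Configurations {0,1}^ℤ, with Bool standing for {0,1} (true = 1).
Config : Set
Config = ℤ → Bool

bitToℕ : Bool → ℕ
bitToℕ true  = 1
bitToℕ false = 0

bit : ℕ → ℕ → Bool
bit N zero with N % 2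
... | zero = false
... | suc _ = true
bit N (suc k) = bit (N / 2) k

localRule : ℕ → Bool → Bool → Bool → Bool
localRule N a b c = bit N (4 ℕ.* bitToℕ a ℕ.+ 2 ℕ.* bitToℕ b ℕ.+ bitToℕ c)

ECA : ℕ → Config → Config
ECA N x i = localRule N (x (i ℤ.- ℤ.1ℤ)) (x i) (x (i ℤ.+ ℤ.1ℤ))

iterate : (Config → Config) → ℕ → Config → Config
iterate F zero    x = x
iterate F (suc t) x = F (iterate F t x)

periodic : ∀ {m} → Vec Bool (suc m) → Config
periodic {m} u i = lookup u (fromℕ< (n%ℕd<d i (suc m)))

patch : ∀ {m n} → Vec Bool (suc m) → Vec Bool n → Config
patch {n = n} u x (+ k) with k ℕ.<? n
... | yes k<n = lookup x (fromℕ< k<n)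
... | no  _   = periodic u (+ k)
patch u x -[1+ k ] = periodic u -[1+ k ]

DiffInInterval : ℕ → Config → Config → Set
DiffInInterval w c d = Σ ℤ λ a → ∀ (i : ℤ) → c i ≢ d i → (a ℤ.≤ i) × (i ℤ.< a ℤ.+ + w)

SInv : (Config → Config) → ∀ {m n} → Vec Bool (suc m) → Vec Bool n → Set
SInv F u x = Σ ℕ λ w → ∀ (t : ℕ) →
  DiffInInterval w (iterate F t (periodic u)) (iterate F t (patch u x))

data Protocol (X Y Z : Set) : Set where
  leaf  : Z → Protocol X Y Z
  alice : (X → Bool) → Protocol X Y Z → Protocol X Y Z → Protocol X Y Z
  bob   : (Y → Bool) → Protocol X Y Z → Protocol X Y Z → Protocol X Y Z

run : ∀ {X Y Z} → Protocol X Y Z → X → Y → Z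
run (leaf z)      x y = z
run (alice f l r) x y = if f x then run l x y else run r x y
run (bob f l r)   x y = if f y then run l x y else run r x y

depth : ∀ {X Y Z} → Protocol X Y Z → ℕ
depth (leaf _)      = 0
depth (alice _ l r) = suc (depth l ℕ.⊔ depth r)
depth (bob _ l r)   = suc (depth l ℕ.⊔ depth r)

-- D(g) ≤ C for a {0,1}-valued g given as a predicate G (g(x,y) = 1 iff G x y):
-- there is a protocol tree of depth ≤ C computing g.
D≤ : ∀ {X Y : Set} → (X → Y → Set) → ℕ → Set
D≤ {X} {Y} G C = Σ (Protocol X Y Bool) λ p →
  (depth p ℕ.≤ C) × (∀ x y → (run p x y ≡ true) ⇔ G x y)

-- D(SInv_{F,u,n}) ≤ C, where D(g) = max over splits n = i + j of D(g_i)
DSInv≤ : (Config → Config) → ∀ {m} → Vec Bool (suc m) → ℕ → ℕ → Set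
DSInv≤ F u n C = ∀ (i j : ℕ) → i ℕ.+ j ≡ n →
  D≤ {Vec Bool i} {Vec Bool j} (λ x y → SInv F u (x ++ y)) C

-- Rule 140 keeps a 1 exactly when its left neighbour is 0 or its right neighbour is 1, so after t
-- steps a cell is 1 iff it was 1 and either its left neighbour was 0 or the t cells to its right were
-- all 1: blocks of 1s erode from the right at speed one, down to their leftmost cell, and 0s never
-- change.  If u contains a 0, the zeros of p_u left of the patch stop any disturbance from travelling
-- left, while right of the patch it never arrives; so the difference stays in a fixed window and
-- SInv is constantly 1.  If u = 1…1, then p_u is a fixed point, and a 0 in x makes the 1s to its left
-- die one after the other; so SInv holds iff x has no 0, which Alice and Bob decide with two bits.
module Submission where

open import Defs
open import Data.Bool using (Bool; true; false; _∧_; _∨_; not)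
open import Data.Bool.Properties using (_≟_; ∧-zeroʳ; ∧-identityʳ; ∨-zeroʳ)
open import Data.Nat as ℕ using (ℕ; zero; suc; z≤n; s≤s; _≤_; _<_; _∸_; _*_; pred)
import Data.Nat.Properties as ℕP
open import Data.Nat.DivMod using (_/_; _%_; [m+kn]%n≡m%n; n%n≡0; m<n⇒m%n≡m; m/n*n≤m; m≥n⇒m/n>0)
open import Data.Integer as ℤ using (ℤ; +_; -[1+_]; 1ℤ; -1ℤ)
import Data.Integer.Properties as ℤP
open import Data.Fin using (toℕ)
open import Data.Fin.Properties using (toℕ<n; fromℕ<-toℕ; fromℕ<-cong)
open import Data.Vec using (Vec; lookup; _++_)
open import Data.Vec.Relation.Unary.All using (All; all?; decide)
open import Data.Vec.Relation.Unary.All.Properties using (lookup⁺; ++⁺; ++⁻)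
open import Data.Vec.Relation.Unary.Any using (Any; index)
open import Data.Vec.Relation.Unary.Any.Properties using (lookup-index)
open import Data.Product using (Σ; _×_; _,_; proj₁; proj₂; uncurry)
open import Data.Sum using (_⊎_; inj₁; inj₂)
open import Function using (_∘_)
open import Function.Bundles using (_⇔_; mk⇔)
open import Function.Construct.Composition using (_⇔-∘_)
open import Function.Construct.Symmetry using (⇔-sym)
open import Relation.Nullary using (¬_; yes; no; contradiction)
open import Relation.Nullary.Decidable using (isYes)
open import Relation.Unary using (Decidable)
open import Relation.Binary.PropositionalEquality

iterate-cong : ∀ N {c d : Config} → (∀ i → c i ≡ d i) →
  ∀ t i → iterate (ECA N) t c i ≡ iterate (ECA N) t d i
iterate-cong N c≗d zero    i = c≗d i
iterate-cong N c≗d (suc t) i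
  rewrite iterate-cong N c≗d t (i ℤ.- 1ℤ) | iterate-cong N c≗d t i
        | iterate-cong N c≗d t (i ℤ.+ 1ℤ) = refl

iterate-ones : ∀ N {c : Config} → localRule N true true true ≡ true → (∀ i → c i ≡ true) →
  ∀ t i → iterate (ECA N) t c i ≡ true
iterate-ones N f111 ones zero    i = ones i
iterate-ones N f111 ones (suc t) i
  rewrite iterate-ones N f111 ones t (i ℤ.- 1ℤ) | iterate-ones N f111 ones t i
        | iterate-ones N f111 ones t (i ℤ.+ 1ℤ) = f111

F₁₄₀ : Config → Config
F₁₄₀ = ECA 140

rule140 : ∀ a b c → localRule 140 a b c ≡ b ∧ (not a ∨ c)
rule140 false false false = refl
rule140 false false true  = refl
rule140 false true  false = refl
rule140 false true  true  = refl
rule140 true  false false = refl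
rule140 true  false true  = refl
rule140 true  true  false = refl
rule140 true  true  true  = refl

onesAfter : ℕ → Config → ℤ → Bool
onesAfter zero    c i = true
onesAfter (suc t) c i = c (i ℤ.+ 1ℤ) ∧ onesAfter t c (i ℤ.+ 1ℤ)

i+1-1≡i : ∀ i → i ℤ.+ 1ℤ ℤ.- 1ℤ ≡ i
i+1-1≡i i = trans (ℤP.+-assoc i 1ℤ -1ℤ) (ℤP.+-identityʳ i)

i-1+1≡i : ∀ i → i ℤ.- 1ℤ ℤ.+ 1ℤ ≡ i
i-1+1≡i i = trans (ℤP.+-assoc i -1ℤ 1ℤ) (ℤP.+-identityʳ i)

onesAfter-suc⇒ : ∀ t c i → onesAfter (suc t) c i ≡ true → onesAfter t c i ≡ true
onesAfter-suc⇒ zero    c i _ = refl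
onesAfter-suc⇒ (suc t) c i h with c (i ℤ.+ 1ℤ)
onesAfter-suc⇒ (suc t) c i h  | true  = onesAfter-suc⇒ t c (i ℤ.+ 1ℤ) h
onesAfter-suc⇒ (suc t) c i () | false

onesAfter-shiftˡ : ∀ t c i → c i ≡ true → onesAfter t c i ≡ true → onesAfter t c (i ℤ.- 1ℤ) ≡ true
onesAfter-shiftˡ zero    c i _  _ = refl
onesAfter-shiftˡ (suc t) c i ci h rewrite i-1+1≡i i | ci = onesAfter-suc⇒ t c i h

onesAfter-zero : ∀ t c i z → z < t → c (i ℤ.+ + suc z) ≡ false → onesAfter t c i ≡ false
onesAfter-zero (suc t) c i zero    _         cz = cong (_∧ onesAfter t c (i ℤ.+ 1ℤ)) cz
onesAfter-zero (suc t) c i (suc z) (s≤s z<t) cz =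
  trans (cong (c (i ℤ.+ 1ℤ) ∧_) (onesAfter-zero t c (i ℤ.+ 1ℤ) z z<t cz′)) (∧-zeroʳ _)
  where
  cz′ : c (i ℤ.+ 1ℤ ℤ.+ + suc z) ≡ false
  cz′ = trans (cong c (ℤP.+-assoc i 1ℤ (+ suc z))) cz

-- a, b, e are c at i-1, i, i+1 and a′ at i-2; P, Q, R are onesAfter t c at i-1, i, i+1.
rule140-step : ∀ a b e a′ P Q R → (b ≡ true → Q ≡ true → P ≡ true) → (e ∧ R ≡ true → Q ≡ true) →
  localRule 140 (a ∧ (not a′ ∨ P)) (b ∧ (not a ∨ Q)) (e ∧ (not b ∨ R)) ≡ b ∧ (not a ∨ (e ∧ R))
rule140-step a     false e a′ P Q     R _   _   = rule140 (a ∧ (not a′ ∨ P)) false (e ∧ true)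
rule140-step false true  e a′ P Q     R _   _   = rule140 false true (e ∧ R)
rule140-step true  true  e a′ P false R _   R⇒Q with e ∧ R | R⇒Q
... | false | _   = rule140 (not a′ ∨ P) false false
... | true  | R⇒F = contradiction (R⇒F refl) λ ()
rule140-step true  true  e a′ P true  R Q⇒P _   rewrite Q⇒P refl refl with a′
... | false = rule140 true true (e ∧ R)
... | true  = rule140 true true (e ∧ R)

iterate140-closed : ∀ t c i → iterate F₁₄₀ t c i ≡ c i ∧ (not (c (i ℤ.- 1ℤ)) ∨ onesAfter t c i)
iterate140-closed zero c i = sym (trans (cong (c i ∧_) (∨-zeroʳ _)) (∧-identityʳ (c i)))
iterate140-closed (suc t) c i
  rewrite iterate140-closed t c (i ℤ.- 1ℤ) | iterate140-closed t c i
        | iterate140-closed t c (i ℤ.+ 1ℤ) | i+1-1≡i i =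
  rule140-step (c (i ℤ.- 1ℤ)) (c i) (c (i ℤ.+ 1ℤ)) (c (i ℤ.- 1ℤ ℤ.- 1ℤ))
    (onesAfter t c (i ℤ.- 1ℤ)) (onesAfter t c i) (onesAfter t c (i ℤ.+ 1ℤ))
    (onesAfter-shiftˡ t c i) (onesAfter-suc⇒ t c i)

iterate140-zero : ∀ t c i → c i ≡ false → iterate F₁₄₀ t c i ≡ false
iterate140-zero t c i ci =
  trans (iterate140-closed t c i) (cong (_∧ (not (c (i ℤ.- 1ℤ)) ∨ onesAfter t c i)) ci)

iterate140-cong : ∀ t c d i → c i ≡ d i → c (i ℤ.- 1ℤ) ≡ d (i ℤ.- 1ℤ) →
  onesAfter t c i ≡ onesAfter t d i → iterate F₁₄₀ t c i ≡ iterate F₁₄₀ t d i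
iterate140-cong t c d i ci cl ones
  rewrite iterate140-closed t c i | iterate140-closed t d i | ci | cl | ones = refl

i≤i+1 : ∀ i → i ℤ.≤ i ℤ.+ 1ℤ
i≤i+1 i = ℤP.i≤i+j i 1ℤ

i-1≤i : ∀ i → i ℤ.- 1ℤ ℤ.≤ i
i-1≤i i = ℤP.i≤j⇒i-k≤j 1ℤ ℤP.≤-refl

i<j⇒i+1≤j : ∀ {i j} → i ℤ.< j → i ℤ.+ 1ℤ ℤ.≤ j
i<j⇒i+1≤j {i} i<j = subst (ℤ._≤ _) (ℤP.+-comm 1ℤ i) (ℤP.i<j⇒suc[i]≤j i<j)

i<j⇒i≤j-1 : ∀ {i j} → i ℤ.< j → i ℤ.≤ j ℤ.- 1ℤ
i<j⇒i≤j-1 {j = j} i<j = subst (_ ℤ.≤_) (ℤP.+-comm -1ℤ j) (ℤP.i<j⇒i≤pred[j] i<j)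

onesAfter-cong-from : ∀ t {c d b} i → (∀ j → b ℤ.≤ j → c j ≡ d j) → b ℤ.≤ i →
  onesAfter t c i ≡ onesAfter t d i
onesAfter-cong-from zero    i _   _   = refl
onesAfter-cong-from (suc t) i c≗d b≤i =
  cong₂ _∧_ (c≗d _ b≤i+1) (onesAfter-cong-from t (i ℤ.+ 1ℤ) c≗d b≤i+1)
  where b≤i+1 = ℤP.≤-trans b≤i (i≤i+1 i)

-- A run of 1s starting right of i stops at the 0 at a, so positions beyond a are never read.
onesAfter-cong-before : ∀ t {c d a} i → (∀ j → j ℤ.≤ a → c j ≡ d j) → c a ≡ false → i ℤ.< a →
  onesAfter t c i ≡ onesAfter t d i
onesAfter-cong-before zero        i _   _  _   = refl
onesAfter-cong-before (suc t) {a = a} i c≗d ca i<a with i ℤ.+ 1ℤ ℤ.≟ a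
... | yes refl rewrite ca | sym (c≗d (i ℤ.+ 1ℤ) ℤP.≤-refl) | ca = refl
... | no i+1≢a =
  cong₂ _∧_ (c≗d _ (i<j⇒i+1≤j i<a))
            (onesAfter-cong-before t (i ℤ.+ 1ℤ) c≗d ca (ℤP.≤∧≢⇒< (i<j⇒i+1≤j i<a) i+1≢a))

iterate140-agree-after : ∀ t {c d b} i → (∀ j → b ℤ.≤ j → c j ≡ d j) → b ℤ.< i →
  iterate F₁₄₀ t c i ≡ iterate F₁₄₀ t d i
iterate140-agree-after t i c≗d b<i = iterate140-cong t _ _ i
  (c≗d i (ℤP.<⇒≤ b<i)) (c≗d _ (i<j⇒i≤j-1 b<i)) (onesAfter-cong-from t i c≗d (ℤP.<⇒≤ b<i))

iterate140-agree-before : ∀ t {c d a} i → (∀ j → j ℤ.≤ a → c j ≡ d j) → c a ≡ false →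
  i ℤ.< a → iterate F₁₄₀ t c i ≡ iterate F₁₄₀ t d i
iterate140-agree-before t i c≗d ca i<a = iterate140-cong t _ _ i
  (c≗d i (ℤP.<⇒≤ i<a)) (c≗d _ (ℤP.≤-trans (i-1≤i i) (ℤP.<⇒≤ i<a)))
  (onesAfter-cong-before t i c≗d ca i<a)

diffInInterval-intro : ∀ w a {c d : Config} → (∀ i → i ℤ.< a → c i ≡ d i) →
  (∀ i → a ℤ.+ + w ℤ.≤ i → c i ≡ d i) → DiffInInterval w c d
diffInInterval-intro w a {c} {d} before after = a , λ i ci≢di → above i ci≢di , below i ci≢di
  where
  above : ∀ i → c i ≢ d i → a ℤ.≤ i
  above i ci≢di with i ℤ.<? a
  ... | yes i<a = contradiction (before i i<a) ci≢di
  ... | no  i≮a = ℤP.≮⇒≥ i≮a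
  below : ∀ i → c i ≢ d i → i ℤ.< a ℤ.+ + w
  below i ci≢di with i ℤ.<? a ℤ.+ + w
  ... | yes i<a+w = i<a+w
  ... | no  i≮a+w = contradiction (after i (ℤP.≮⇒≥ i≮a+w)) ci≢di

diffInInterval-width : ∀ {w c d} → DiffInInterval w c d → ∀ {i j} → c i ≢ d i → c j ≢ d j →
  j ℤ.< i ℤ.+ + w
diffInInterval-width {w} (a , confined) ci≢di cj≢dj =
  ℤP.<-≤-trans (proj₂ (confined _ cj≢dj)) (ℤP.+-monoˡ-≤ (+ w) (proj₁ (confined _ ci≢di)))

-[1+m]+[1+m+k]≡k : ∀ m k → -[1+ m ] ℤ.+ + suc (m ℕ.+ k) ≡ + k
-[1+m]+[1+m+k]≡k m k = trans (ℤP.≤-⊖ (s≤s (ℕP.m≤m+n m k))) (cong +_ (ℕP.m+n∸m≡n m k))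

-[1+m]+m≡-1 : ∀ m → -[1+ m ] ℤ.+ + m ≡ -1ℤ
-[1+m]+m≡-1 m = trans (ℤP.⊖-< (ℕP.n<1+n m)) (cong (ℤ.-_ ∘ +_) (ℕP.m+n∸n≡m 1 m))

-- The value of `ℤ._%ℕ_` on -[1+ j ], as a function of suc j % d.
negRem : ℕ → ℕ → ℕ
negRem d zero    = 0
negRem d (suc r) = d ∸ suc r

-[1+]%ℕ : ∀ j d .{{_ : ℕ.NonZero d}} → -[1+ j ] ℤ.%ℕ d ≡ negRem d (suc j % d)
-[1+]%ℕ j d with suc j % d
... | zero  = refl
... | suc _ = refl

-[1+m∸r+q*[1+m]]%ℕ[1+m]≡r : ∀ m r q → r ≤ m → -[1+ m ∸ r ℕ.+ q * suc m ] ℤ.%ℕ suc m ≡ r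
-[1+m∸r+q*[1+m]]%ℕ[1+m]≡r m zero q _ = begin
  -[1+ m ℕ.+ q * suc m ] ℤ.%ℕ suc m
    ≡⟨ -[1+]%ℕ (m ℕ.+ q * suc m) (suc m) ⟩
  negRem (suc m) ((suc m ℕ.+ q * suc m) % suc m)
    ≡⟨ cong (negRem (suc m)) ([m+kn]%n≡m%n (suc m) q (suc m)) ⟩
  negRem (suc m) (suc m % suc m)
    ≡⟨ cong (negRem (suc m)) (n%n≡0 (suc m)) ⟩
  0 ∎
  where open ≡-Reasoning
-[1+m∸r+q*[1+m]]%ℕ[1+m]≡r m (suc r) q r<m = begin
  -[1+ m ∸ suc r ℕ.+ q * suc m ] ℤ.%ℕ suc m
    ≡⟨ -[1+]%ℕ (m ∸ suc r ℕ.+ q * suc m) (suc m) ⟩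
  negRem (suc m) ((suc (m ∸ suc r) ℕ.+ q * suc m) % suc m)
    ≡⟨ cong (negRem (suc m)) ([m+kn]%n≡m%n (suc (m ∸ suc r)) q (suc m)) ⟩
  negRem (suc m) (suc (m ∸ suc r) % suc m)
    ≡⟨ cong (negRem (suc m)) (m<n⇒m%n≡m m∸r<m) ⟩
  m ∸ (m ∸ suc r)
    ≡⟨ ℕP.m∸[m∸n]≡n r<m ⟩
  suc r ∎
  where
  open ≡-Reasoning
  m∸r<m : suc (m ∸ suc r) < suc m
  m∸r<m = s≤s (ℕP.∸-monoʳ-< {m} {suc r} {0} (s≤s z≤n) r<m)

periodic-ones : ∀ {m} (u : Vec Bool (suc m)) → All (_≡ true) u → ∀ i → periodic u i ≡ true
periodic-ones u ones i = lookup⁺ ones _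

periodic-zero-before : ∀ {m} (u : Vec Bool (suc m)) → Any (_≡ false) u →
  ∀ k → suc m ≤ k → Σ ℕ λ j → j < k × periodic u -[1+ j ] ≡ false
periodic-zero-before {m} u has0 k L≤k = j , j<k , pj
  where
  r : ℕ
  r = toℕ (index has0)
  r≤m : r ≤ m
  r≤m = ℕP.≤-pred (toℕ<n (index has0))
  -- -[1+ j ] = r - (q + 1)(m + 1) is the copy of the zero u[r] in the leftmost whole period of p_u
  -- that still fits between -[1+ k ] and the origin.
  q j : ℕ
  q = pred (k / suc m)
  j = m ∸ r ℕ.+ q * suc m
  j<k : j < k
  j<k = begin
    suc j             ≤⟨ ℕP.+-monoˡ-≤ (q * suc m) (s≤s (ℕP.m∸n≤m m r)) ⟩
    suc q * suc m     ≡⟨ cong (_* suc m) (ℕP.suc-pred (k / suc m) {{ℕ.>-nonZero (m≥n⇒m/n>0 L≤k)}}) ⟩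
    k / suc m * suc m ≤⟨ m/n*n≤m k (suc m) ⟩
    k                 ∎
    where open ℕP.≤-Reasoning
  pj : periodic u -[1+ j ] ≡ false
  pj = trans (cong (lookup u) (trans (fromℕ<-cong _ _ (-[1+m∸r+q*[1+m]]%ℕ[1+m]≡r m r q r≤m) _ r<L)
                                     (fromℕ<-toℕ (index has0) r<L)))
             (lookup-index has0)
    where r<L = toℕ<n (index has0)

ones-or-zero : ∀ {n} (v : Vec Bool n) → All (_≡ true) v ⊎ Any (_≡ false) v
ones-or-zero = decide λ { true → inj₁ refl ; false → inj₂ refl }

module _ {m n : ℕ} (u : Vec Bool (suc m)) (x : Vec Bool n) where

  patch-beyond : ∀ {k} → n ≤ k → patch u x (+ k) ≡ periodic u (+ k)
  patch-beyond {k} n≤k with k ℕ.<? n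
  ... | yes k<n = contradiction n≤k (ℕP.<⇒≱ k<n)
  ... | no  _   = refl

  patch-lookup : ∀ f → patch u x (+ toℕ f) ≡ lookup x f
  patch-lookup f with toℕ f ℕ.<? n
  ... | yes f<n = cong (lookup x) (fromℕ<-toℕ f f<n)
  ... | no  f≮n = contradiction (toℕ<n f) f≮n

  patch-ones : All (_≡ true) u → All (_≡ true) x → ∀ i → patch u x i ≡ true
  patch-ones onesᵤ onesₓ (+ k) with k ℕ.<? n
  ... | yes _ = lookup⁺ onesₓ _
  ... | no  _ = lookup⁺ onesᵤ _
  patch-ones onesᵤ onesₓ -[1+ k ] = lookup⁺ onesᵤ _

  sinv-of-zero : Any (_≡ false) u → SInv F₁₄₀ u x
  sinv-of-zero has0 = suc m ℕ.+ suc n , λ t → diffInInterval-intro _ -[1+ m ] (before t) (after t)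
    where
    p q : Config
    p = periodic u
    q = patch u x
    before : ∀ t i → i ℤ.< -[1+ m ] → iterate F₁₄₀ t p i ≡ iterate F₁₄₀ t q i
    before t -[1+ k ] (ℤ.-<- m<k) with periodic-zero-before u has0 k m<k
    ... | j , j<k , pj = iterate140-agree-before t -[1+ k ] agree pj (ℤ.-<- j<k)
      where
      agree : ∀ i → i ℤ.≤ -[1+ j ] → p i ≡ q i
      agree -[1+ _ ] _ = refl
    after : ∀ t i → -[1+ m ] ℤ.+ + (suc m ℕ.+ suc n) ℤ.≤ i → iterate F₁₄₀ t p i ≡ iterate F₁₄₀ t q i
    after t i window≤i =
      iterate140-agree-after t i agree (ℤP.<-≤-trans (ℤ.+<+ (ℕP.n<1+n n)) n<i)
      where
      agree : ∀ i → + n ℤ.≤ i → p i ≡ q i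
      agree (+ k) (ℤ.+≤+ n≤k) = sym (patch-beyond n≤k)
      n<i : + suc n ℤ.≤ i
      n<i = subst (ℤ._≤ i) (-[1+m]+[1+m+k]≡k m (suc n)) window≤i

  sinv-of-ones : All (_≡ true) u → All (_≡ true) x → SInv F₁₄₀ u x
  sinv-of-ones onesᵤ onesₓ = 0 , λ t → diffInInterval-intro 0 (+ 0) (λ i _ → same t i) (λ i _ → same t i)
    where
    same : ∀ t i → iterate F₁₄₀ t (periodic u) i ≡ iterate F₁₄₀ t (patch u x) i
    same = iterate-cong 140 λ i → trans (periodic-ones u onesᵤ i) (sym (patch-ones onesᵤ onesₓ i))

  -- With t = w + k + 1 the 0 at k has erased every 1 from -[1+ w ] up to k, a stretch longer than w.
  ¬sinv-of-zero : All (_≡ true) u → Any (_≡ false) x → ¬ SInv F₁₄₀ u x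
  ¬sinv-of-zero onesᵤ has0 (w , confined) =
    contradiction (subst (+ k ℤ.<_) (-[1+m]+m≡-1 w) (diffInInterval-width (confined t) differ-i₀ differ-k))
                  λ ()
    where
    k t : ℕ
    k = toℕ (index has0)
    t = suc (w ℕ.+ k)
    i₀ : ℤ
    i₀ = -[1+ w ]
    p q : Config
    p = periodic u
    q = patch u x
    qk≡0 : q (+ k) ≡ false
    qk≡0 = trans (patch-lookup (index has0)) (lookup-index has0)
    differ : ∀ {i} → iterate F₁₄₀ t q i ≡ false → iterate F₁₄₀ t p i ≢ iterate F₁₄₀ t q i
    differ q≡0 p≡q =
      contradiction (trans (sym (iterate-ones 140 refl (periodic-ones u onesᵤ) t _)) (trans p≡q q≡0)) λ ()
    differ-k : iterate F₁₄₀ t p (+ k) ≢ iterate F₁₄₀ t q (+ k)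
    differ-k = differ (iterate140-zero t q (+ k) qk≡0)
    differ-i₀ : iterate F₁₄₀ t p i₀ ≢ iterate F₁₄₀ t q i₀
    differ-i₀ = differ (begin
      iterate F₁₄₀ t q i₀
        ≡⟨ iterate140-closed t q i₀ ⟩
      q i₀ ∧ (not (q (i₀ ℤ.- 1ℤ)) ∨ onesAfter t q i₀)
        ≡⟨ cong (λ b → q i₀ ∧ (not (q (i₀ ℤ.- 1ℤ)) ∨ b))
                (onesAfter-zero t q i₀ (w ℕ.+ k) (ℕP.n<1+n _) (trans (cong q (-[1+m]+[1+m+k]≡k w k)) qk≡0)) ⟩
      q i₀ ∧ (not (q (i₀ ℤ.- 1ℤ)) ∨ false)
        ≡⟨ cong (λ a → q i₀ ∧ (not a ∨ false)) (periodic-ones u onesᵤ (i₀ ℤ.- 1ℤ)) ⟩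
      q i₀ ∧ false
        ≡⟨ ∧-zeroʳ _ ⟩
      false ∎)
      where open ≡-Reasoning

  sinv⇔ones : All (_≡ true) u → SInv F₁₄₀ u x ⇔ All (_≡ true) x
  sinv⇔ones onesᵤ = mk⇔ to (sinv-of-ones onesᵤ)
    where
    to : SInv F₁₄₀ u x → All (_≡ true) x
    to sinv with ones-or-zero x
    ... | inj₁ onesₓ = onesₓ
    ... | inj₂ has0  = contradiction sinv (¬sinv-of-zero onesᵤ has0)

D≤-resp-⇔ : ∀ {X Y : Set} {G H : X → Y → Set} {C} → (∀ x y → G x y ⇔ H x y) → D≤ G C → D≤ H C
D≤-resp-⇔ G⇔H (p , depth≤C , correct) = p , depth≤C , λ x y → G⇔H x y ⇔-∘ correct x y

D≤-trivial : ∀ {X Y : Set} {G : X → Y → Set} → (∀ x y → G x y) → D≤ G 0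
D≤-trivial holds = leaf true , z≤n , λ x y → mk⇔ (λ _ → holds x y) (λ _ → refl)

D≤-× : ∀ {X Y : Set} {P : X → Set} {Q : Y → Set} → Decidable P → Decidable Q →
  D≤ (λ x y → P x × Q y) 2
D≤-× {X} {Y} {P} {Q} P? Q? = protocol , ℕP.≤-refl , correct
  where
  protocol : Protocol X Y Bool
  protocol = alice (isYes ∘ P?) (bob (isYes ∘ Q?) (leaf true) (leaf false)) (leaf false)
  correct : ∀ x y → (run protocol x y ≡ true) ⇔ (P x × Q y)
  correct x y with P? x | Q? y
  ... | yes px | yes qy = mk⇔ (λ _ → px , qy) (λ _ → refl)
  ... | yes _  | no ¬qy = mk⇔ (λ ()) (λ (_ , qy) → contradiction qy ¬qy)
  ... | no ¬px | _      = mk⇔ (λ ()) (λ (px , _) → contradiction px ¬px)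

proposition9 : ∀ (m : ℕ) (u : Vec Bool (suc m)) →
    Σ ℕ λ C → Σ ℕ λ n₀ → ∀ (n : ℕ) → n₀ ≤ n → DSInv≤ (ECA 140) u n C
proposition9 m u with ones-or-zero u
... | inj₁ onesᵤ = 2 , 0 , λ _ _ _ _ _ → D≤-resp-⇔ split (D≤-× (all? (_≟ true)) (all? (_≟ true)))
  where
  split : ∀ {i j} (x : Vec Bool i) (y : Vec Bool j) →
    (All (_≡ true) x × All (_≡ true) y) ⇔ SInv F₁₄₀ u (x ++ y)
  split x y = ⇔-sym (sinv⇔ones u (x ++ y) onesᵤ) ⇔-∘ mk⇔ (uncurry ++⁺) (++⁻ x)
... | inj₂ has0 = 0 , 0 , λ _ _ _ _ _ → D≤-trivial λ x y → sinv-of-zero u (x ++ y) has0
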